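{- For every integer $n \ge 1$, the graph $G_n$ (defined in the context) satisfies $\chi(G_n) = \omega(G_n) = 2n+1$.
   Context: All graphs are finite and simple; $\chi$ denotes chromatic number and $\omega$ clique number. Let $G_1$ be the graph with 8 vertices $w,x,y,z,a_w,a_x,a_y,a_z$ and 16 edges: $wx, xz, zy, yw$ (so $wz, xy$ are non-edges), and for each $v \in \{w,x,y,z\}$ the edges $v a_u$ for every $u \in \{w,x,y,z\}\setminus\{v\}$; there are no other edges (in particular $a_w,a_x,a_y,a_z$ are pairwise non-adjacent and $v a_v$ is a non-edge). For $n \ge 2$, $G_n$ is obtained from $G_1$ by substituting a separate (vertex-disjoint) copy of $G_{n-1}$ for each of the four vertices $a_w,a_x,a_y,a_z$, where substituting $H$ for a vertex $a$ of $G$ means taking the disjoint union of $G-a$ and $H$ and joining every vertex of $H$ to every neighbour of $a$ in $G$. -}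

module Defs where

open import Data.Nat using (ℕ; zero; suc; _≤_; NonZero)
open import Data.Fin using (Fin; zero; suc; _≟_)
open import Data.Bool using (Bool; true; false; T; _∧_; not)
open import Data.Product using (Σ; _×_)
open import Relation.Nullary using (¬_)
open import Relation.Nullary.Decidable using (⌊_⌋)
open import Relation.Binary.PropositionalEquality using (_≡_; _≢_)
open import Function.Definitions using (Injective)

record Graph : Set₁ where
  field
    Vertex : Set
    Adj    : Vertex → Vertex → Set

open Graph public

Colourable : Graph → ℕ → Set
Colourable G k =
  Σ (Vertex G → Fin k) λ c → ∀ u v → Adj G u v → c u ≢ c v

HasClique : Graph → ℕ → Set
HasClique G k =
  Σ (Fin k → Vertex G) λ f →
    Injective _≡_ _≡_ f × (∀ i j → i ≢ j → Adj G (f i) (f j))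

ChromaticNumber : Graph → ℕ → Set
ChromaticNumber G k = Colourable G k × (∀ m → Colourable G m → k ≤ m)

CliqueNumber : Graph → ℕ → Set
CliqueNumber G k = HasClique G k × (∀ m → HasClique G m → m ≤ k)

-- The graphs G_n.
-- Core vertices w,x,y,z are encoded as Fin 4: w = 0, x = 1, y = 2, z = 3.
-- The C4 on the core has edges wx, xz, zy, yw (non-edges wz, xy).

coreAdj : Fin 4 → Fin 4 → Bool
coreAdj zero (suc zero)                   = true
coreAdj zero (suc (suc zero))             = true
coreAdj (suc zero) zero                   = true
coreAdj (suc zero) (suc (suc (suc zero))) = true
coreAdj (suc (suc zero)) zero             = true
coreAdj (suc (suc zero)) (suc (suc (suc zero))) = true
coreAdj (suc (suc (suc zero))) (suc zero) = true
coreAdj (suc (suc (suc zero))) (suc (suc zero)) = true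
coreAdj _ _ = false

neq : Fin 4 → Fin 4 → Bool
neq u v = not ⌊ u ≟ v ⌋

-- VG k = vertex set of G_{k+1}.
--   core v   : the vertex v ∈ {w,x,y,z}
--   att u    : (only in G_1) the vertex a_u
--   sub u h  : (in G_{k+2}) the vertex h of the copy of G_{k+1}
--              substituted for a_u
data VG : ℕ → Set where
  core : ∀ {k} → Fin 4 → VG k
  att  : Fin 4 → VG zero
  sub  : ∀ {k} → Fin 4 → VG k → VG (suc k)

adjG : ∀ {k} → VG k → VG k → Bool
adjG (core u) (core v)   = coreAdj u v
adjG (core v) (att u)    = neq v u
adjG (att u) (core v)    = neq v u
adjG (att _) (att _)     = false
adjG (core v) (sub u _)  = neq v u
adjG (sub u _) (core v)  = neq v u
adjG (sub u h) (sub u' h') = ⌊ u ≟ u' ⌋ ∧ adjG h h'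

G : (n : ℕ) → .{{NonZero n}} → Graph
G (suc k) = record { Vertex = VG k ; Adj = λ u v → T (adjG u v) }

{-# OPTIONS --safe #-}
-- ω ≤ χ holds in every graph, so it suffices to exhibit a clique and a proper
-- colouring of G_n of the same size 2n + 1.  The copy substituted for a_w is joined
-- to x and z, so x, z and a largest clique of that copy form a clique, adding two
-- vertices per level.  Conversely the 4-cycle on w, x, y, z is 2-coloured by its
-- bipartition {w, z}, {x, y}; the four substituted copies are pairwise non-adjacent,
-- so they can all reuse one colouring of G_{n-1} shifted past those two colours.
module Submission where

open import Defs
open import Data.Nat using (ℕ; suc; zero; _+_; _*_; NonZero; _≤_)
open import Data.Nat.Properties using (*-comm)
open import Data.Product using (_×_; _,_; proj₂)
open import Data.Fin using (Fin; zero; suc; _≟_)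
open import Data.Fin.Properties using (injective⇒≤; suc-injective)
open import Data.Bool using (T)
open import Data.Bool.Properties using (T-∧)
open import Function.Bundles using (Equivalence)
open import Function.Definitions using (Injective)
open import Relation.Nullary using (¬_; yes; no; contradiction)
open import Relation.Binary.PropositionalEquality using (_≡_; _≢_; refl; sym; cong; subst)

module _ (Γ : Graph) where

  clique≤colours : ∀ {m k} → HasClique Γ m → Colourable Γ k → m ≤ k
  clique≤colours (f , _ , adj) (c , proper) = injective⇒≤ c∘f-injective
    where
    c∘f-injective : Injective _≡_ _≡_ (λ i → c (f i))
    c∘f-injective {i} {j} c[fi]≡c[fj] with i ≟ j
    ... | yes i≡j = i≡j
    ... | no  i≢j = contradiction c[fi]≡c[fj] (proper (f i) (f j) (adj i j i≢j))

  pairwiseAdjacent⇒injective : (∀ v → ¬ Adj Γ v v) → ∀ {k} (f : Fin k → Vertex Γ) →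
                               (∀ i j → i ≢ j → Adj Γ (f i) (f j)) → Injective _≡_ _≡_ f
  pairwiseAdjacent⇒injective irrefl f adj {i} {j} fi≡fj with i ≟ j
  ... | yes i≡j = i≡j
  ... | no  i≢j = contradiction (subst (λ v → Adj Γ (f i) v) (sym fi≡fj) (adj i j i≢j)) (irrefl (f i))

  clique×colouring⇒χ≡ω : ∀ {k} → HasClique Γ k → Colourable Γ k → ChromaticNumber Γ k × CliqueNumber Γ k
  clique×colouring⇒χ≡ω clique colouring =
    (colouring , λ _ colouring′ → clique≤colours clique colouring′) ,
    (clique , λ _ clique′ → clique≤colours clique′ colouring)

pattern w = zero
pattern x = suc zero
pattern y = suc (suc zero)
pattern z = suc (suc (suc zero))

-- Written suc k * 2 rather than 2 * suc k so that size (suc k) reduces to suc (suc (size k)).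
size : ℕ → ℕ
size k = suc k * 2 + 1

Gₖ : ℕ → Graph
Gₖ k = G (suc k)

adjG-irrefl : ∀ {k} (v : VG k) → ¬ T (adjG v v)
adjG-irrefl (core w) ()
adjG-irrefl (core x) ()
adjG-irrefl (core y) ()
adjG-irrefl (core z) ()
adjG-irrefl (att w) ()
adjG-irrefl (att x) ()
adjG-irrefl (att y) ()
adjG-irrefl (att z) ()
adjG-irrefl (sub u h) adj = adjG-irrefl h (proj₂ (Equivalence.to T-∧ adj))

bipartition : ∀ {m} → Fin 4 → Fin (2 + m)
bipartition w = zero
bipartition x = suc zero
bipartition y = suc zero
bipartition z = zero

bipartition-proper : ∀ {m} u v → T (coreAdj u v) → bipartition {m} u ≢ bipartition v
bipartition-proper w x _ ()
bipartition-proper w y _ ()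
bipartition-proper x w _ ()
bipartition-proper x z _ ()
bipartition-proper y w _ ()
bipartition-proper y z _ ()
bipartition-proper z x _ ()
bipartition-proper z y _ ()
bipartition-proper w w ()
bipartition-proper w z ()
bipartition-proper x x ()
bipartition-proper x y ()
bipartition-proper y x ()
bipartition-proper y y ()
bipartition-proper z w ()
bipartition-proper z z ()

bipartition≢shifted : ∀ {m} v (i : Fin m) → bipartition v ≢ suc (suc i)
bipartition≢shifted w _ ()
bipartition≢shifted x _ ()
bipartition≢shifted y _ ()
bipartition≢shifted z _ ()

colour : ∀ k → VG k → Fin (size k)
colour k       (core v)  = bipartition v
colour zero    (att _)   = suc (suc zero)
colour (suc k) (sub _ h) = suc (suc (colour k h))

colour-proper : ∀ k (u v : VG k) → T (adjG u v) → colour k u ≢ colour k v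
colour-proper k       (core u)  (core v)    adj = bipartition-proper u v adj
colour-proper zero    (core v)  (att _)     _   = bipartition≢shifted v zero
colour-proper zero    (att _)   (core v)    _ e = bipartition≢shifted v zero (sym e)
colour-proper (suc k) (core v)  (sub _ h)   _   = bipartition≢shifted v (colour k h)
colour-proper (suc k) (sub _ h) (core v)    _ e = bipartition≢shifted v (colour k h) (sym e)
colour-proper (suc k) (sub u h) (sub u′ h′) adj e =
  colour-proper k h h′ (proj₂ (Equivalence.to T-∧ adj)) (suc-injective (suc-injective e))

clique : ∀ k → Fin (size k) → VG k
clique k       zero          = core x
clique k       (suc zero)    = core z
clique zero    (suc (suc _)) = att w
clique (suc k) (suc (suc i)) = sub w (clique k i)

clique-adjacent : ∀ k i j → i ≢ j → T (adjG (clique k i) (clique k j))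
clique-adjacent k       zero          zero          i≢j = contradiction refl i≢j
clique-adjacent k       zero          (suc zero)    _   = _
clique-adjacent k       (suc zero)    zero          _   = _
clique-adjacent k       (suc zero)    (suc zero)    i≢j = contradiction refl i≢j
clique-adjacent zero    zero          (suc (suc _)) _   = _
clique-adjacent zero    (suc zero)    (suc (suc _)) _   = _
clique-adjacent zero    (suc (suc _)) zero          _   = _
clique-adjacent zero    (suc (suc _)) (suc zero)    _   = _
clique-adjacent zero    (suc (suc zero)) (suc (suc zero)) i≢j = contradiction refl i≢j
clique-adjacent (suc k) zero          (suc (suc _)) _   = _
clique-adjacent (suc k) (suc zero)    (suc (suc _)) _   = _
clique-adjacent (suc k) (suc (suc _)) zero          _   = _
clique-adjacent (suc k) (suc (suc _)) (suc zero)    _   = _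
clique-adjacent (suc k) (suc (suc i)) (suc (suc j)) i≢j =
  clique-adjacent k i j (λ i≡j → i≢j (cong (λ l → suc (suc l)) i≡j))

Gₖ-colourable : ∀ k → Colourable (Gₖ k) (size k)
Gₖ-colourable k = colour k , colour-proper k

Gₖ-hasClique : ∀ k → HasClique (Gₖ k) (size k)
Gₖ-hasClique k =
  clique k , pairwiseAdjacent⇒injective (Gₖ k) adjG-irrefl (clique k) (clique-adjacent k) ,
  clique-adjacent k

lemma5 : ∀ (n : ℕ) .{{_ : NonZero n}} →
         ChromaticNumber (G n) (2 * n + 1) × CliqueNumber (G n) (2 * n + 1)
lemma5 (suc k) =
  subst (λ m → ChromaticNumber (Gₖ k) m × CliqueNumber (Gₖ k) m)
        (cong (_+ 1) (*-comm (suc k) 2))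
        (clique×colouring⇒χ≡ω (Gₖ k) (Gₖ-hasClique k) (Gₖ-colourable k))
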